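{- Let $G$ be an interval graph given with a nice path decomposition $(B_1,\dots,B_\ell)$ in which every bag $B_i$ induces a clique in $G$, and let $G_i=G[B_1\cup\dots\cup B_i]$. Let $(G,k,h)$ be a yes-instance of $\mathcal{T}_{h+1}$-Free Edge Deletion, let $F$ be an optimal solution, and let $F_i=F\cap E(G_i)$. Then for every bag $B_i$, at most one connected component of $G_i\setminus F_i$ that intersects $B_i$ has more than $k+1$ vertices.
   Context: $\mathcal{T}_{h+1}$-Free Edge Deletion: given a simple undirected graph $G$ and positive integers $k,h$, decide whether there is $F\subseteq E(G)$ with $|F|\le k$ such that every connected component of $G\setminus F$ has at most $h$ vertices; an optimal solution is such an $F$ of minimum size. A graph is an interval graph if its vertices can be assigned intervals of the real line so that two vertices are adjacent iff their intervals intersect. A path decomposition is a sequence of bags $B_1,\dots,B_\ell\subseteq V(G)$ covering all vertices, such that each edge lies in some bag and the bags containing any vertex form a contiguous subsequence; it is nice if $B_1=B_\ell=\emptyset$ and each $B_{i}$ ($i>1$) is obtained from $B_{i-1}$ by adding exactly one vertex or removing exactly one vertex. -}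

module Defs where

open import Data.Nat using (ℕ; zero; suc; _+_; _≤_; _<_; _<ᵇ_)
open import Data.Fin using (Fin; toℕ)
open import Data.Fin.Subset using (Subset; _∈_; _∉_; _∪_; ⁅_⁆) renaming (⊥ to ∅)
open import Data.Bool using (Bool; true; false; T; _∧_; not; if_then_else_)
open import Data.List using (List; length; map; allFin)
open import Data.Nat.ListAction using (sum)
open import Data.List.Relation.Unary.All using (All)
open import Data.List.Relation.Unary.Unique.Propositional using (Unique)
open import Data.Product using (Σ; ∃; _×_)
open import Data.Sum using (_⊎_)
open import Data.Unit using (⊤)
open import Data.Rational as ℚ using (ℚ)
open import Relation.Binary.PropositionalEquality using (_≡_; _≢_)

record Graph (n : ℕ) : Set where
  field
    Adj     : Fin n → Fin n → Bool
    symm    : ∀ u v → Adj u v ≡ Adj v u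
    irrefl  : ∀ u → Adj u u ≡ false
open Graph public

-- Interval graph: closed intervals [l v , r v] (rational endpoints; for finite
-- graphs this is no loss compared to real endpoints), distinct vertices adjacent
-- iff their intervals intersect.
IsIntervalGraph : ∀ {n} → Graph n → Set
IsIntervalGraph {n} G =
  Σ (Fin n → ℚ) λ l → Σ (Fin n → ℚ) λ r →
    (∀ v → l v ℚ.≤ r v) ×
    (∀ u v → u ≢ v →
       (T (Adj G u v) → (l u ℚ.≤ r v × l v ℚ.≤ r u)) ×
       ((l u ℚ.≤ r v × l v ℚ.≤ r u) → T (Adj G u v)))

-- Nice path decomposition with bags B 1, ..., B ℓ
-- (values of B outside 1..ℓ are irrelevant).
record NicePathDecomposition {n} (G : Graph n) (ℓ : ℕ) (B : ℕ → Subset n) : Set where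
  field
    ℓ≥1        : 1 ≤ ℓ
    cover      : ∀ v → ∃ λ i → 1 ≤ i × i ≤ ℓ × v ∈ B i
    edgeCover  : ∀ u v → T (Adj G u v) → ∃ λ i → 1 ≤ i × i ≤ ℓ × u ∈ B i × v ∈ B i
    contig     : ∀ v i j k → 1 ≤ i → i ≤ j → j ≤ k → k ≤ ℓ →
                 v ∈ B i → v ∈ B k → v ∈ B j
    firstEmpty : B 1 ≡ ∅
    lastEmpty  : B ℓ ≡ ∅
    step       : ∀ i → 1 ≤ i → suc i ≤ ℓ →
                 (∃ λ v → v ∉ B i × B (suc i) ≡ B i ∪ ⁅ v ⁆) ⊎
                 (∃ λ v → v ∉ B (suc i) × B i ≡ B (suc i) ∪ ⁅ v ⁆)

BagsAreCliques : ∀ {n} → Graph n → ℕ → (ℕ → Subset n) → Set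
BagsAreCliques G ℓ B =
  ∀ i → 1 ≤ i → i ≤ ℓ → ∀ u v → u ∈ B i → v ∈ B i → u ≢ v → T (Adj G u v)

record EdgeSet {n} (G : Graph n) : Set where
  field
    mem    : Fin n → Fin n → Bool
    msymm  : ∀ u v → mem u v ≡ mem v u
    ⊆E     : ∀ u v → T (mem u v) → T (Adj G u v)
open EdgeSet public

size : ∀ {n} {G : Graph n} → EdgeSet G → ℕ
size {n} F =
  sum (map (λ u → sum (map (λ v → if (toℕ u <ᵇ toℕ v) ∧ mem F u v then 1 else 0)
                           (allFin n)))
           (allFin n))

-- Reachability in the graph with vertex set P and edge relation "Adj G ∖ F"
-- (i.e. in (G[P]) ∖ F).
data Reach {n} (G : Graph n) (F : EdgeSet G) (P : Fin n → Set) : Fin n → Fin n → Set where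
  here  : ∀ {u} → P u → Reach G F P u u
  step  : ∀ {u v w} → P u → T (Adj G u v) → T (not (mem F u v)) →
          Reach G F P v w → Reach G F P u w

ComponentAtMost : ∀ {n} (G : Graph n) (F : EdgeSet G) (P : Fin n → Set) → Fin n → ℕ → Set
ComponentAtMost {n} G F P u h =
  ∀ (xs : List (Fin n)) → Unique xs → All (Reach G F P u) xs → length xs ≤ h

ComponentMoreThan : ∀ {n} (G : Graph n) (F : EdgeSet G) (P : Fin n → Set) → Fin n → ℕ → Set
ComponentMoreThan {n} G F P u m =
  ∃ λ (xs : List (Fin n)) → Unique xs × All (Reach G F P u) xs × m < length xs

AllVertices : ∀ {n} → Fin n → Set
AllVertices _ = ⊤

IsSolution : ∀ {n} (G : Graph n) → ℕ → EdgeSet G → Set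
IsSolution G h F = ∀ u → ComponentAtMost G F AllVertices u h

YesInstance : ∀ {n} (G : Graph n) → ℕ → ℕ → Set
YesInstance G k h = ∃ λ (F : EdgeSet G) → IsSolution G h F × size F ≤ k

IsOptimal : ∀ {n} (G : Graph n) → ℕ → EdgeSet G → Set
IsOptimal G h F = IsSolution G h F × (∀ (F' : EdgeSet G) → IsSolution G h F' → size F ≤ size F')

Prefix : ∀ {n} → (ℕ → Subset n) → ℕ → Fin n → Set
Prefix B i v = ∃ λ j → 1 ≤ j × j ≤ i × v ∈ B j

{-# OPTIONS --safe #-}

-- Let C_u and C_w be the components of u and w in G_i ∖ F, both with more than |F| vertices
-- (|F| ≤ k by optimality), and let B_t be the first bag meeting C_u ∪ C_w, say at x ∈ C_u.
-- Every y ∈ C_w lies in a bag B_j with t ≤ j ≤ i, and the path in C_u from x ∈ B_t to u ∈ B_i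
-- passes through some c ∈ B_j, which is adjacent to y because B_j is a clique. If C_u ≠ C_w,
-- all these edges cy lie in F and are pairwise distinct (c ∉ C_w), so |C_w| ≤ |F|: impossible.

module Submission where

open import Defs
open import Level using (0ℓ)
open import Function using (id; _∘_)
open import Data.Nat using (ℕ; suc; _+_; _≤_; _<_; _<ᵇ_; z≤n; s≤s)
open import Data.Nat.Properties
open import Data.Nat.ListAction using (sum)
open import Data.Nat.ListAction.Properties using (sum-++)
open import Data.Fin using (Fin; toℕ)
open import Data.Fin.Properties using (toℕ-injective) renaming (_≟_ to _≟ᶠ_)
open import Data.Fin.Subset using (Subset; _∈_)
open import Data.Bool using (true; false; T; _∧_; not; if_then_else_)
open import Data.List using (List; []; _∷_; _++_; length; map; allFin; cartesianProduct)
open import Data.List.Properties using (map-++; map-∘)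
open import Data.List.Relation.Unary.All as All using (All; []; _∷_)
import Data.List.Relation.Unary.All.Properties as All
open import Data.List.Relation.Unary.Any as Any using (Any; here; there)
import Data.List.Relation.Unary.Any.Properties as Any
open import Data.List.Relation.Unary.AllPairs using ([]; _∷_)
open import Data.List.Relation.Unary.Unique.Propositional using (Unique)
open import Data.List.Membership.Propositional using () renaming (_∈_ to _∈ₗ_; _∉_ to _∉ₗ_)
open import Data.List.Membership.Propositional.Properties
  using (∈-∃++; ∈-++⁻; ∈-++⁺ˡ; ∈-++⁺ʳ; ∈-allFin; ∈-cartesianProduct⁺)
open import Data.Product as Product using (∃; ∃₂; _×_; _,_)
open import Data.Sum using (_⊎_; inj₁; inj₂; [_,_]′)
open import Data.Sum.Effectful.Left using (applicative)
open import Data.Empty using (⊥-elim)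
open import Relation.Nullary using (yes; no)
open import Relation.Binary.PropositionalEquality

sum-map-++ : ∀ {A : Set} (g : A → ℕ) xs ys →
  sum (map g (xs ++ ys)) ≡ sum (map g xs) + sum (map g ys)
sum-map-++ g xs ys = trans (cong sum (map-++ g xs ys)) (sum-++ (map g xs) (map g ys))

sum-map-cartesianProduct : ∀ {A B : Set} (g : A × B → ℕ) xs ys →
  sum (map g (cartesianProduct xs ys)) ≡ sum (map (λ x → sum (map (λ y → g (x , y)) ys)) xs)
sum-map-cartesianProduct g []       ys = refl
sum-map-cartesianProduct g (x ∷ xs) ys = begin
  sum (map g (map (x ,_) ys ++ cartesianProduct xs ys))
    ≡⟨ sum-map-++ g (map (x ,_) ys) (cartesianProduct xs ys) ⟩
  sum (map g (map (x ,_) ys)) + sum (map g (cartesianProduct xs ys))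
    ≡⟨ cong₂ _+_ (cong sum (sym (map-∘ ys))) (sum-map-cartesianProduct g xs ys) ⟩
  sum (map (λ y → g (x , y)) ys) + sum (map (λ x → sum (map (λ y → g (x , y)) ys)) xs) ∎
  where open ≡-Reasoning

∈-++-∷⁻ : ∀ {A : Set} {a x : A} xs ys → x ∈ₗ xs ++ a ∷ ys → a ≢ x → x ∈ₗ xs ++ ys
∈-++-∷⁻ xs ys x∈ a≢x with ∈-++⁻ xs x∈
... | inj₁ x∈xs         = ∈-++⁺ˡ x∈xs
... | inj₂ (here refl)  = ⊥-elim (a≢x refl)
... | inj₂ (there x∈ys) = ∈-++⁺ʳ xs x∈ys

length≤sum-map : ∀ {A : Set} (g : A → ℕ) (E : List A) {L : List A} →
  Unique L → All (_∈ₗ E) L → All (λ a → 1 ≤ g a) L → length L ≤ sum (map g E)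
length≤sum-map g E {[]}    _                  _             _             = z≤n
length≤sum-map g E {a ∷ L} (a∉L ∷ L-unique) (a∈E ∷ L⊆E) (1≤ga ∷ 1≤gL) with ∈-∃++ a∈E
... | E₁ , E₂ , refl = begin
  suc (length L)
    ≤⟨ s≤s (length≤sum-map g (E₁ ++ E₂) L-unique L⊆E₁++E₂ 1≤gL) ⟩
  suc (sum (map g (E₁ ++ E₂)))
    ≡⟨ cong suc (sum-map-++ g E₁ E₂) ⟩
  suc (sum (map g E₁) + sum (map g E₂))
    ≡⟨ sym (+-suc (sum (map g E₁)) (sum (map g E₂))) ⟩
  sum (map g E₁) + suc (sum (map g E₂))
    ≤⟨ +-monoʳ-≤ (sum (map g E₁)) (+-monoˡ-≤ (sum (map g E₂)) 1≤ga) ⟩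
  sum (map g E₁) + (g a + sum (map g E₂))
    ≡⟨ sym (sum-map-++ g E₁ (a ∷ E₂)) ⟩
  sum (map g (E₁ ++ a ∷ E₂)) ∎
  where
  open ≤-Reasoning
  L⊆E₁++E₂ : All (_∈ₗ E₁ ++ E₂) L
  L⊆E₁++E₂ = All.zipWith (Product.uncurry (∈-++-∷⁻ E₁ E₂)) (L⊆E , a∉L)

least-witness : ∀ {A : Set} (Q : A → ℕ → Set) (z : A) (zs : List A) →
  All (λ z → ∃ (Q z)) (z ∷ zs) →
  ∃ λ t → Any (λ z → Q z t) (z ∷ zs) × All (λ z → ∃ λ j → t ≤ j × Q z j) (z ∷ zs)
least-witness Q z []        ((j , q) ∷ []) = j , here q , (j , ≤-refl , q) ∷ []
least-witness Q z (z′ ∷ zs) ((j , q) ∷ qs) with least-witness Q z′ zs qs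
... | t , attained , above with ≤-total j t
...   | inj₁ j≤t =
  j , here q , (j , ≤-refl , q) ∷ All.map (Product.map₂ (Product.map₁ (≤-trans j≤t))) above
...   | inj₂ t≤j = t , there attained , (j , t≤j , q) ∷ above

module _ {n} {G : Graph n} {F : EdgeSet G} {P : Fin n → Set} where

  reach-target : ∀ {u v} → Reach G F P u v → P v
  reach-target (here pv)       = pv
  reach-target (step _ _ _ r) = reach-target r

  reach-trans : ∀ {u v w} → Reach G F P u v → Reach G F P v w → Reach G F P u w
  reach-trans (here _)        r′ = r′
  reach-trans (step pu a m r) r′ = step pu a m (reach-trans r r′)

  reach-snoc : ∀ {u v w} → Reach G F P u v → P w → T (Adj G v w) → T (not (mem F v w)) →
    Reach G F P u w
  reach-snoc r pw a m = reach-trans r (step (reach-target r) a m (here pw))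

  reach-sym : ∀ {u v} → Reach G F P u v → Reach G F P v u
  reach-sym (here pu)               = here pu
  reach-sym (step {u} {v} pu a m r) =
    reach-snoc (reach-sym r) pu (subst T (symm G u v) a) (subst (T ∘ not) (msymm F u v) m)

module _ {n} {G : Graph n} {ℓ} {B : ℕ → Subset n} (D : NicePathDecomposition G ℓ B) where
  open NicePathDecomposition D using (edgeCover; contig)

  reach-meets-bag : ∀ {F P a b ta tb t} → Reach G F P a b →
    1 ≤ ta → tb ≤ ℓ → a ∈ B ta → b ∈ B tb → ta ≤ t → t ≤ tb →
    ∃ λ c → Reach G F P a c × c ∈ B t
  reach-meets-bag (here pa) 1≤ta tb≤ℓ a∈Bta b∈Btb ta≤t t≤tb =
    _ , here pa , contig _ _ _ _ 1≤ta ta≤t t≤tb tb≤ℓ a∈Bta b∈Btb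
  reach-meets-bag {a = a} {t = t} (step pa a~a′ a′∉F r) 1≤ta tb≤ℓ a∈Bta b∈Btb ta≤t t≤tb
    with edgeCover _ _ a~a′
  ... | s , 1≤s , s≤ℓ , a∈Bs , a′∈Bs with ≤-total t s
  ...   | inj₁ t≤s = a , here pa , contig a _ _ _ 1≤ta ta≤t t≤s s≤ℓ a∈Bta a∈Bs
  ...   | inj₂ s≤t = Product.map₂ (Product.map₁ (step pa a~a′ a′∉F))
                       (reach-meets-bag r 1≤s tb≤ℓ a′∈Bs b∈Btb s≤t t≤tb)

ordered : ∀ {n} → Fin n → Fin n → Fin n × Fin n
ordered u v with toℕ u <ᵇ toℕ v
... | true  = u , v
... | false = v , u

ordered-≡-inv : ∀ {n} {a b c d : Fin n} → ordered a b ≡ ordered c d →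
  (a ≡ c × b ≡ d) ⊎ (a ≡ d × b ≡ c)
ordered-≡-inv {a = a} {b} {c} {d} eq
  with toℕ a <ᵇ toℕ b | toℕ c <ᵇ toℕ d | eq
... | true  | true  | refl = inj₁ (refl , refl)
... | true  | false | refl = inj₂ (refl , refl)
... | false | true  | refl = inj₂ (refl , refl)
... | false | false | refl = inj₁ (refl , refl)

module _ {n} {G : Graph n} (F : EdgeSet G) where

  edgeCount : Fin n × Fin n → ℕ
  edgeCount (u , v) = if (toℕ u <ᵇ toℕ v) ∧ mem F u v then 1 else 0

  size≡sum-edgeCount : size F ≡ sum (map edgeCount (cartesianProduct (allFin n) (allFin n)))
  size≡sum-edgeCount = sym (sum-map-cartesianProduct edgeCount (allFin n) (allFin n))

  edgeCount-pos : ∀ {u v} → T (toℕ u <ᵇ toℕ v) → T (mem F u v) → 1 ≤ edgeCount (u , v)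
  edgeCount-pos {u} {v} _ _ with toℕ u <ᵇ toℕ v | mem F u v
  ... | true | true = s≤s z≤n

  edgeCount-ordered : ∀ {u v} → T (mem F u v) → u ≢ v → 1 ≤ edgeCount (ordered u v)
  edgeCount-ordered {u} {v} uv∈F u≢v with toℕ u <ᵇ toℕ v in u<ᵇv
  ... | true  = edgeCount-pos (subst T (sym u<ᵇv) _) uv∈F
  ... | false = edgeCount-pos (<⇒<ᵇ v<u) (subst T (msymm F u v) uv∈F)
    where
    v<u : toℕ v < toℕ u
    v<u = ≤∧≢⇒< (≮⇒≥ (λ u<v → subst T u<ᵇv (<⇒<ᵇ u<v))) (u≢v ∘ toℕ-injective ∘ sym)

  LeavingEdge : List (Fin n) → Fin n → Set
  LeavingEdge ys y = ∃ λ c → c ∉ₗ ys × T (mem F c y)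

  leavingPairs : ∀ {ys zs} → All (LeavingEdge ys) zs → List (Fin n × Fin n)
  leavingPairs []                          = []
  leavingPairs {zs = z ∷ _} ((c , _) ∷ es) = ordered c z ∷ leavingPairs es

  length-leavingPairs : ∀ {ys zs} (es : All (LeavingEdge ys) zs) →
    length (leavingPairs es) ≡ length zs
  length-leavingPairs []       = refl
  length-leavingPairs (_ ∷ es) = cong suc (length-leavingPairs es)

  ∈-leavingPairs⁻ : ∀ {ys zs p} (es : All (LeavingEdge ys) zs) → p ∈ₗ leavingPairs es →
    ∃₂ λ c z → z ∈ₗ zs × c ∉ₗ ys × p ≡ ordered c z
  ∈-leavingPairs⁻ ((c , c∉ys , _) ∷ es) (here refl) = c , _ , here refl , c∉ys , refl
  ∈-leavingPairs⁻ (_ ∷ es)              (there p∈)  =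
    Product.map₂ (Product.map₂ (Product.map₁ there)) (∈-leavingPairs⁻ es p∈)

  leavingPairs-pos : ∀ {ys zs} → All (_∈ₗ ys) zs → (es : All (LeavingEdge ys) zs) →
    All (λ p → 1 ≤ edgeCount p) (leavingPairs es)
  leavingPairs-pos []             []                       = []
  leavingPairs-pos (z∈ys ∷ zs⊆ys) ((c , c∉ys , cz∈F) ∷ es) =
    edgeCount-ordered cz∈F (λ { refl → c∉ys z∈ys }) ∷ leavingPairs-pos zs⊆ys es

  leavingPairs-unique : ∀ {ys zs} → All (_∈ₗ ys) zs → Unique zs →
    (es : All (LeavingEdge ys) zs) → Unique (leavingPairs es)
  leavingPairs-unique [] [] [] = []
  leavingPairs-unique {zs = z ∷ zs} (z∈ys ∷ zs⊆ys) (z∉zs ∷ zs-unique) ((c , _) ∷ es) =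
    All.tabulate fresh ∷ leavingPairs-unique zs⊆ys zs-unique es
    where
    fresh : ∀ {p} → p ∈ₗ leavingPairs es → ordered c z ≢ p
    fresh p∈ eq with ∈-leavingPairs⁻ es p∈
    ... | c′ , z′ , z′∈zs , c′∉ys , refl with ordered-≡-inv eq
    ...   | inj₁ (_ , refl) = All.lookup z∉zs z′∈zs refl
    ...   | inj₂ (_ , refl) = c′∉ys z∈ys

  length≤size : ∀ {ys} → Unique ys → All (LeavingEdge ys) ys → length ys ≤ size F
  length≤size {ys} ys-unique es = begin
    length ys
      ≡⟨ sym (length-leavingPairs es) ⟩
    length (leavingPairs es)
      ≤⟨ length≤sum-map edgeCount _ (leavingPairs-unique ys⊆ys ys-unique es) allPairs
                                    (leavingPairs-pos ys⊆ys es) ⟩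
    sum (map edgeCount (cartesianProduct (allFin n) (allFin n)))
      ≡⟨ sym size≡sum-edgeCount ⟩
    size F ∎
    where
    open ≤-Reasoning
    ys⊆ys : All (_∈ₗ ys) ys
    ys⊆ys = All.tabulate id
    allPairs : All (_∈ₗ cartesianProduct (allFin n) (allFin n)) (leavingPairs es)
    allPairs = All.tabulate λ { {u , v} _ → ∈-cartesianProduct⁺ (∈-allFin u) (∈-allFin v) }

module _ {n} {G : Graph n} {F : EdgeSet G} {ℓ} {B : ℕ → Subset n}
         (D : NicePathDecomposition G ℓ B) (cliques : BagsAreCliques G ℓ B)
         {i} (i≤ℓ : i ≤ ℓ) where

  private
    Rᵢ : Fin n → Fin n → Set
    Rᵢ = Reach G F (Prefix B i)

  joined-or-leaving : ∀ {u w x t ys} → u ∈ B i → Rᵢ u x → x ∈ B t → 1 ≤ t →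
    All (Rᵢ w) ys → All (λ y → ∃ λ j → t ≤ j × 1 ≤ j × j ≤ i × y ∈ B j) ys →
    Rᵢ u w ⊎ All (LeavingEdge F ys) ys
  joined-or-leaving {u} {w} {ys = ys} u∈Bᵢ u↝x x∈Bₜ 1≤t w↝ys ys-late =
    All.sequenceA 0ℓ (applicative (Rᵢ u w) 0ℓ) (All.tabulate joined-or-leaves)
    where
    joined-or-leaves : ∀ {y} → y ∈ₗ ys → Rᵢ u w ⊎ LeavingEdge F ys y
    joined-or-leaves {y} y∈ys with All.lookup ys-late y∈ys | All.lookup w↝ys y∈ys
    ... | j , t≤j , 1≤j , j≤i , y∈Bⱼ | w↝y
      with Product.map₂ (Product.map₁ (reach-trans u↝x))
             (reach-meets-bag D (reach-sym u↝x) 1≤t i≤ℓ x∈Bₜ u∈Bᵢ t≤j j≤i)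
    ... | c , u↝c , c∈Bⱼ with Any.any? (c ≟ᶠ_) ys
    ...   | yes c∈ys = inj₁ (reach-trans u↝c (reach-sym (All.lookup w↝ys c∈ys)))
    ...   | no c∉ys with mem F c y in cy∈F
    ...     | true  = inj₂ (c , c∉ys , subst T (sym cy∈F) _)
    ...     | false = inj₁ (reach-trans (reach-snoc u↝c (reach-target w↝y) c~y cy∉F) (reach-sym w↝y))
      where
      c~y : T (Adj G c y)
      c~y = cliques j 1≤j (≤-trans j≤i i≤ℓ) c y c∈Bⱼ y∈Bⱼ λ { refl → c∉ys y∈ys }
      cy∉F : T (not (mem F c y))
      cy∉F = subst (T ∘ not) (sym cy∈F) _

  reaches-later-heavy-component : ∀ {u w t xs ys} → u ∈ B i → All (Rᵢ u) xs →
    Any (λ x → 1 ≤ t × t ≤ i × x ∈ B t) xs →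
    Unique ys → All (Rᵢ w) ys → All (λ y → ∃ λ j → t ≤ j × 1 ≤ j × j ≤ i × y ∈ B j) ys →
    size F < length ys → Rᵢ u w
  reaches-later-heavy-component u∈Bᵢ u↝xs early ys-unique w↝ys ys-late |F|<|ys|
    with All.lookupAny u↝xs early
  ... | u↝x , 1≤t , _ , x∈Bₜ =
    [ id , (λ leaving → ⊥-elim (<⇒≱ |F|<|ys| (length≤size F ys-unique leaving))) ]′
      (joined-or-leaving u∈Bᵢ u↝x x∈Bₜ 1≤t w↝ys ys-late)

  heavy-components-meet : ∀ {u w} → u ∈ B i → w ∈ B i →
    ComponentMoreThan G F (Prefix B i) u (size F) →
    ComponentMoreThan G F (Prefix B i) w (size F) →
    Rᵢ u w
  heavy-components-meet _ _ ([] , _ , _ , ())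
  heavy-components-meet u∈Bᵢ w∈Bᵢ (x ∷ xs , xs-unique , u↝xs , |F|<|xs|)
                                   (ys , ys-unique , w↝ys , |F|<|ys|)
    with least-witness (λ z j → 1 ≤ j × j ≤ i × z ∈ B j) x (xs ++ ys)
                       (All.++⁺ (All.map reach-target u↝xs) (All.map reach-target w↝ys))
  ... | t , earliest , late with Any.++⁻ (x ∷ xs) earliest | All.++⁻ (x ∷ xs) late
  ...   | inj₁ early-in-xs | _ , ys-late =
    reaches-later-heavy-component u∈Bᵢ u↝xs early-in-xs ys-unique w↝ys ys-late |F|<|ys|
  ...   | inj₂ early-in-ys | xs-late , _ = reach-sym
    (reaches-later-heavy-component w∈Bᵢ w↝ys early-in-ys xs-unique u↝xs xs-late |F|<|xs|)

ComponentMoreThan-antimono : ∀ {n} {G : Graph n} {F : EdgeSet G} {P : Fin n → Set} {u m m′} →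
  m ≤ m′ → ComponentMoreThan G F P u m′ → ComponentMoreThan G F P u m
ComponentMoreThan-antimono m≤m′ = Product.map₂ (Product.map₂ (Product.map₂ (≤-<-trans m≤m′)))

lemma4 : ∀ {n} (G : Graph n) (ℓ : ℕ) (B : ℕ → Subset n) (k h : ℕ) →
    IsIntervalGraph G →
    NicePathDecomposition G ℓ B →
    BagsAreCliques G ℓ B →
    1 ≤ k → 1 ≤ h →
    YesInstance G k h →
    (F : EdgeSet G) → IsOptimal G h F →
    ∀ i → 1 ≤ i → i ≤ ℓ →
    ∀ u w → u ∈ B i → w ∈ B i →
    ComponentMoreThan G F (Prefix B i) u (k + 1) →
    ComponentMoreThan G F (Prefix B i) w (k + 1) →
    Reach G F (Prefix B i) u w
lemma4 G ℓ B k h _ D cliques _ _ (F₀ , F₀-solution , |F₀|≤k) F (_ , F-minimum) i _ i≤ℓ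
       u w u∈Bᵢ w∈Bᵢ u-heavy w-heavy =
  heavy-components-meet D cliques i≤ℓ u∈Bᵢ w∈Bᵢ
    (ComponentMoreThan-antimono |F|≤k+1 u-heavy) (ComponentMoreThan-antimono |F|≤k+1 w-heavy)
  where
  |F|≤k+1 : size F ≤ k + 1
  |F|≤k+1 = ≤-trans (F-minimum F₀ F₀-solution) (≤-trans |F₀|≤k (m≤m+n k 1))
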